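{- Let $n\ge 3$, let $1\le i_0<j_0\le n$ with $j_0\ge i_0+2$, let $\alpha=\varepsilon_{i_0}-\varepsilon_{j_0}$, $s=s_\alpha$, and let $w\in S_n$ satisfy $w(i_0)<w(j_0)$ and such that no $k$ with $i_0<k<j_0$ satisfies $w(i_0)<w(k)<w(j_0)$; put $w'=ws$. With $\kappa_\beta$, bad roots and $\mathfrak{D}_\beta$ as defined in the context, let $\beta=\alpha_{lm}$ be a negative root. If $l\le j_0$ or $m>i_0$, then $\kappa_\beta\le\kappa_{\beta_1}+\kappa_{\beta_2}$ for all $(\beta_1,\beta_2)\in\mathfrak{D}_\beta$. Moreover, if there exists $(\beta_1,\beta_2)\in\mathfrak{D}_\beta$ with $\kappa_\beta>\kappa_{\beta_1}+\kappa_{\beta_2}$, then: $l>j_0$ and $m\le i_0$; $\kappa_\beta=1$ and $\kappa_{\beta_1}=\kappa_{\beta_2}=0$; $\beta_1$ shares the row of $-\alpha$, $\beta_2$ is bad, and either $s(\beta_1)$ is a bad (negative) root or $\beta_1=-\alpha$.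
   Context: $S_n$ acts on $\mathbb{Z}^n$ by $w(\varepsilon_i)=\varepsilon_{w(i)}$, where $\varepsilon_i$ is the standard basis. For $l\ne m$ put $\alpha_{lm}=\varepsilon_l-\varepsilon_m$; it is a positive root ($>0$) if $l<m$ and a negative root ($<0$) if $l>m$; $\Phi^-$ is the set of negative roots, and $w(\alpha_{lm})=\alpha_{w(l)w(m)}$. $s=s_\alpha$ is the transposition $(i_0\,j_0)$. $\delta_P$ is $1$ if $P$ holds and $0$ otherwise. For a negative root $\beta=\alpha_{lm}$ ($l>m$): $\beta$ shares the row of $\alpha$ if $l=i_0$, the column of $\alpha$ if $m=j_0$, the row of $-\alpha$ if $l=j_0$, and the column of $-\alpha$ if $m=i_0$. $\beta$ is bad if it shares the row or the column of $\alpha$ and $\delta_{w(\beta)<0}\ne\delta_{w'(\beta)<0}$. Define $\kappa_\beta=\delta_{w'(\beta)<0}$ if $l=j_0$, and $\kappa_\beta=\delta_{w(\beta)<0}$ otherwise. $\mathfrak{D}_\beta=\{(\alpha_{km},\alpha_{lk}): m<k<l\}$ (decompositions of $\beta$ into two negative roots, the first sharing the column of $\beta$, the second sharing its row). -}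

module Defs where

open import Data.Nat using (ℕ)
open import Data.Bool using (Bool; true; false; if_then_else_)
open import Data.Fin using (Fin; _<?_; _<_)
import Data.Fin
import Relation.Nullary
open import Data.Fin.Permutation using (Permutation′; _⟨$⟩ʳ_; transpose)
open import Data.Product using (_×_)
open import Data.Sum using (_⊎_)
open import Relation.Nullary.Decidable using (⌊_⌋)
open import Relation.Binary.PropositionalEquality using (_≡_; _≢_)

-- Indices are 0-based (Fin n); the order is the same as in the paper.
-- A root α_{lm} (l ≠ m) is represented by the pair (l , m); it is negative iff m < l.

s : ∀ {n} → Fin n → Fin n → Fin n → Fin n
s i₀ j₀ x = transpose i₀ j₀ ⟨$⟩ʳ x

w′ : ∀ {n} → Permutation′ n → Fin n → Fin n → Fin n → Fin n
w′ w i₀ j₀ x = w ⟨$⟩ʳ (s i₀ j₀ x)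

-- δ_{u(α_{lm}) < 0}, i.e. whether α_{u(l) u(m)} is negative: u(m) < u(l)
δneg : ∀ {n} → (Fin n → Fin n) → Fin n → Fin n → Bool
δneg u l m = ⌊ u m <? u l ⌋

toℕᵇ : Bool → ℕ
toℕᵇ b = if b then 1 else 0

κ : ∀ {n} → Permutation′ n → Fin n → Fin n → Fin n → Fin n → ℕ
κ w i₀ j₀ l m with Data.Fin._≟_ l j₀
... | Relation.Nullary.yes _ = toℕᵇ (δneg (w′ w i₀ j₀) l m)
... | Relation.Nullary.no _  = toℕᵇ (δneg (w ⟨$⟩ʳ_) l m)

-- β = α_{lm} (assumed negative) is bad
Bad : ∀ {n} → Permutation′ n → Fin n → Fin n → Fin n → Fin n → Set
Bad w i₀ j₀ l m =
  (l ≡ i₀ ⊎ m ≡ j₀) × (δneg (w ⟨$⟩ʳ_) l m ≢ δneg (w′ w i₀ j₀) l m)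

{-# OPTIONS --safe #-}
-- Write W for w and W′ = W ∘ s.  Off the row of j₀, κ records an inversion of W; in the
-- row of j₀ it records an inversion of W′, i.e. κ(j₀, m) = [W (s m) < W i₀].  Inversions
-- of a single permutation are subadditive (the complement of "<" is transitive), so a
-- violation κ(l,m) = 1, κ(k,m) = κ(l,k) = 0 must mix the two permutations: l = j₀ is
-- impossible because W i₀ < W j₀, so k = j₀ < l.  Then W l < W j₀, W i₀ < W l, and if
-- m ≠ i₀ also W i₀ < W m; the gap condition on W over ]i₀, j₀[ forces m < i₀.
module Submission where

open import Defs
open import Data.Bool using (Bool; true; false)
open import Data.Empty using (⊥; ⊥-elim)
open import Data.Fin using (Fin; toℕ; _<_; _<?_; _≟_)
import Data.Fin.Properties as Fin
open import Data.Fin.Permutation using (Permutation′; _⟨$⟩ʳ_)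
open import Data.Nat using (ℕ; suc; _≤_; _>_; z≤n; s≤s)
open import Data.Nat as ℕ using ()
import Data.Nat.Properties as ℕ
open import Data.Product using (_×_; _,_; ∃-syntax)
open import Data.Sum using (_⊎_; inj₁; inj₂)
open import Function.Bundles using (Injection)
open import Function.Properties.Inverse using (↔⇒↣)
open import Relation.Binary.PropositionalEquality using (_≡_; _≢_; refl; sym; trans; cong; subst₂)
open import Relation.Nullary using (¬_; Dec; yes; no)
open import Relation.Nullary.Decidable using (⌊_⌋; dec-true; dec-false)

private
  variable
    n : ℕ
    a b c : ℕ
    i j x : Fin n

s-left : (i j : Fin n) → s i j i ≡ j
s-left i j rewrite dec-true (i ≟ i) refl = refl

s-right : (i j : Fin n) → s i j j ≡ i
s-right i j with j ≟ i
... | yes j≡i = j≡i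
... | no _ rewrite dec-true (j ≟ j) refl = refl

s-fix : x ≢ i → x ≢ j → s i j x ≡ x
s-fix {x = x} {i} {j} x≢i x≢j rewrite dec-false (x ≟ i) x≢i | dec-false (x ≟ j) x≢j = refl

toℕᵇ≤1 : (b : Bool) → toℕᵇ b ≤ 1
toℕᵇ≤1 true  = s≤s z≤n
toℕᵇ≤1 false = z≤n

toℕᵇ-⌊⌋≡1 : ∀ {p} {P : Set p} (p? : Dec P) → toℕᵇ ⌊ p? ⌋ ≡ 1 → P
toℕᵇ-⌊⌋≡1 (yes p) _ = p

toℕᵇ-⌊⌋≡0 : ∀ {p} {P : Set p} (p? : Dec P) → toℕᵇ ⌊ p? ⌋ ≡ 0 → ¬ P
toℕᵇ-⌊⌋≡0 (no ¬p) _ = ¬p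

⌊⌋-≢ : ∀ {p q} {P : Set p} {Q : Set q} (p? : Dec P) (q? : Dec Q) → ¬ P → Q → ⌊ p? ⌋ ≢ ⌊ q? ⌋
⌊⌋-≢ (yes p) _       ¬p _ _ = ¬p p
⌊⌋-≢ (no _)  (yes _) _  _ ()
⌊⌋-≢ (no _)  (no ¬q) _  q _ = ¬q q

≤1⇒≤+⊎1>0+0 : a ≤ 1 → a ≤ b ℕ.+ c ⊎ (a ≡ 1 × b ≡ 0 × c ≡ 0)
≤1⇒≤+⊎1>0+0                     z≤n       = inj₁ z≤n
≤1⇒≤+⊎1>0+0 {b = suc _}         (s≤s z≤n) = inj₁ (s≤s z≤n)
≤1⇒≤+⊎1>0+0 {b = 0} {c = suc _} (s≤s z≤n) = inj₁ (s≤s z≤n)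
≤1⇒≤+⊎1>0+0 {b = 0} {c = 0}     (s≤s z≤n) = inj₂ (refl , refl , refl)

≮-trans : {x y z : Fin n} → ¬ x < y → ¬ y < z → ¬ x < z
≮-trans x≮y y≮z x<z = ℕ.<⇒≱ x<z (ℕ.≤-trans (ℕ.≮⇒≥ y≮z) (ℕ.≮⇒≥ x≮y))

≮∧≢⇒> : {x y : Fin n} → ¬ x < y → x ≢ y → y < x
≮∧≢⇒> x≮y x≢y = Fin.≤∧≢⇒< (ℕ.≮⇒≥ x≮y) (λ y≡x → x≢y (sym y≡x))

module _ {n} (w : Permutation′ n) (i₀ j₀ : Fin n) where

  private
    W : Fin n → Fin n
    W = w ⟨$⟩ʳ_

    W-injective : W i ≡ W j → i ≡ j
    W-injective = Injection.injective (↔⇒↣ w)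

    s′ : Fin n → Fin n
    s′ = s i₀ j₀

    κ′ : Fin n → Fin n → ℕ
    κ′ = κ w i₀ j₀

  ViolationShape : Fin n → Fin n → Fin n → Set
  ViolationShape l m k = (j₀ < l × toℕ m ≤ toℕ i₀) × k ≡ j₀ × Bad w i₀ j₀ l k
    × ((s′ m < s′ k × Bad w i₀ j₀ (s′ k) (s′ m)) ⊎ (k ≡ j₀ × m ≡ i₀))

  NoValueBetween : Set
  NoValueBetween = ¬ (∃[ k ] (i₀ < k × k < j₀ × W i₀ < W k × W k < W j₀))

  κ≤1 : ∀ l m → κ′ l m ≤ 1
  κ≤1 l m with l ≟ j₀
  ... | yes _ = toℕᵇ≤1 _
  ... | no _  = toℕᵇ≤1 _

  κ-row-j₀ : ∀ m → κ′ j₀ m ≡ toℕᵇ ⌊ W (s′ m) <? W i₀ ⌋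
  κ-row-j₀ m with j₀ ≟ j₀
  ... | yes _    = cong (λ y → toℕᵇ ⌊ W (s′ m) <? W y ⌋) (s-right i₀ j₀)
  ... | no j₀≢j₀ = ⊥-elim (j₀≢j₀ refl)

  κ-row-other : ∀ {l} m → l ≢ j₀ → κ′ l m ≡ toℕᵇ ⌊ W m <? W l ⌋
  κ-row-other {l} m l≢j₀ with l ≟ j₀
  ... | yes l≡j₀ = ⊥-elim (l≢j₀ l≡j₀)
  ... | no _     = refl

  κ-row-j₀≡1 : ∀ {m} → κ′ j₀ m ≡ 1 → W (s′ m) < W i₀
  κ-row-j₀≡1 {m} κ≡1 = toℕᵇ-⌊⌋≡1 _ (trans (sym (κ-row-j₀ m)) κ≡1)

  κ-row-j₀≡0 : ∀ {m} → κ′ j₀ m ≡ 0 → ¬ W (s′ m) < W i₀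
  κ-row-j₀≡0 {m} κ≡0 = toℕᵇ-⌊⌋≡0 _ (trans (sym (κ-row-j₀ m)) κ≡0)

  κ-row-other≡1 : ∀ {l m} → l ≢ j₀ → κ′ l m ≡ 1 → W m < W l
  κ-row-other≡1 {m = m} l≢j₀ κ≡1 = toℕᵇ-⌊⌋≡1 _ (trans (sym (κ-row-other m l≢j₀)) κ≡1)

  κ-row-other≡0 : ∀ {l m} → l ≢ j₀ → κ′ l m ≡ 0 → ¬ W m < W l
  κ-row-other≡0 {m = m} l≢j₀ κ≡0 = toℕᵇ-⌊⌋≡0 _ (trans (sym (κ-row-other m l≢j₀)) κ≡0)

  Bad-intro : ∀ {l m} → (l ≡ i₀ ⊎ m ≡ j₀) → ¬ W m < W l → W (s′ m) < W (s′ l) → Bad w i₀ j₀ l m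
  Bad-intro {l} {m} shares W≮ W′< = shares , ⌊⌋-≢ (W m <? W l) (W (s′ m) <? W (s′ l)) W≮ W′<

  no-violation-in-row-j₀ : ∀ {m k} → W i₀ < W j₀ → m < k → k < j₀ →
    κ′ j₀ m ≡ 1 → κ′ k m ≡ 0 → κ′ j₀ k ≡ 0 → ⊥
  no-violation-in-row-j₀ {m} {k} Wi₀<Wj₀ m<k k<j₀ κj₀m≡1 κkm≡0 κj₀k≡0 with m ≟ i₀
  ... | yes refl = ℕ.<-asym Wi₀<Wj₀ (subst₂ (λ y z → W y < W z) (s-left i₀ j₀) refl (κ-row-j₀≡1 κj₀m≡1))
  ... | no m≢i₀ = contradiction-via (k ≟ i₀)
    where
      Wm<Wi₀ : W m < W i₀
      Wm<Wi₀ = subst₂ (λ y z → W y < W z) (s-fix m≢i₀ (Fin.<⇒≢ (Fin.<-trans m<k k<j₀))) refl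
                 (κ-row-j₀≡1 κj₀m≡1)
      Wm≮Wk : ¬ W m < W k
      Wm≮Wk = κ-row-other≡0 (Fin.<⇒≢ k<j₀) κkm≡0
      contradiction-via : Dec (k ≡ i₀) → ⊥
      contradiction-via (yes refl) = Wm≮Wk Wm<Wi₀
      contradiction-via (no k≢i₀)  = ≮-trans Wm≮Wk Wk≮Wi₀ Wm<Wi₀
        where
          Wk≮Wi₀ : ¬ W k < W i₀
          Wk≮Wi₀ = subst₂ (λ y z → ¬ W y < W z) (s-fix k≢i₀ (Fin.<⇒≢ k<j₀)) refl (κ-row-j₀≡0 κj₀k≡0)

  violation-outside-row-j₀⇒k≡j₀ : ∀ {l m k} → l ≢ j₀ →
    κ′ l m ≡ 1 → κ′ k m ≡ 0 → κ′ l k ≡ 0 → k ≡ j₀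
  violation-outside-row-j₀⇒k≡j₀ {k = k} l≢j₀ κlm≡1 κkm≡0 κlk≡0 = by-cases (k ≟ j₀)
    where
      by-cases : Dec (k ≡ j₀) → k ≡ j₀
      by-cases (yes k≡j₀) = k≡j₀
      by-cases (no k≢j₀)  = ⊥-elim (≮-trans (κ-row-other≡0 k≢j₀ κkm≡0) (κ-row-other≡0 l≢j₀ κlk≡0)
                                            (κ-row-other≡1 l≢j₀ κlm≡1))

  violation-through-j₀ : ∀ {l m} → i₀ < j₀ → NoValueBetween → m < j₀ → j₀ < l →
    κ′ l m ≡ 1 → κ′ j₀ m ≡ 0 → κ′ l j₀ ≡ 0 →
    toℕ m ≤ toℕ i₀ × Bad w i₀ j₀ l j₀
    × ((s′ m < s′ j₀ × Bad w i₀ j₀ (s′ j₀) (s′ m)) ⊎ (j₀ ≡ j₀ × m ≡ i₀))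
  violation-through-j₀ {l} {m} i₀<j₀ gap m<j₀ j₀<l κlm≡1 κj₀m≡0 κlj₀≡0 = by-cases (m ≟ i₀)
    where
      l≢j₀ : l ≢ j₀
      l≢j₀ l≡j₀ = Fin.<⇒≢ j₀<l (sym l≡j₀)
      l≢i₀ : l ≢ i₀
      l≢i₀ l≡i₀ = Fin.<⇒≢ (Fin.<-trans i₀<j₀ j₀<l) (sym l≡i₀)
      Wm<Wl : W m < W l
      Wm<Wl = κ-row-other≡1 l≢j₀ κlm≡1
      Wj₀≮Wl : ¬ W j₀ < W l
      Wj₀≮Wl = κ-row-other≡0 l≢j₀ κlj₀≡0
      Wl<Wj₀ : W l < W j₀
      Wl<Wj₀ = ≮∧≢⇒> Wj₀≮Wl (λ Wj₀≡Wl → l≢j₀ (sym (W-injective Wj₀≡Wl)))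
      Bad-l-j₀ : W i₀ < W l → Bad w i₀ j₀ l j₀
      Bad-l-j₀ Wi₀<Wl = Bad-intro (inj₂ refl) Wj₀≮Wl
        (subst₂ (λ y z → W y < W z) (sym (s-right i₀ j₀)) (sym (s-fix l≢i₀ l≢j₀)) Wi₀<Wl)

      by-cases : Dec (m ≡ i₀) → toℕ m ≤ toℕ i₀ × Bad w i₀ j₀ l j₀
        × ((s′ m < s′ j₀ × Bad w i₀ j₀ (s′ j₀) (s′ m)) ⊎ (j₀ ≡ j₀ × m ≡ i₀))
      by-cases (yes refl) = ℕ.≤-refl , Bad-l-j₀ Wm<Wl , inj₂ (refl , refl)
      by-cases (no m≢i₀)  = m≤i₀ , Bad-l-j₀ (Fin.<-trans Wi₀<Wm Wm<Wl) , inj₁ (sm<sj₀ , Bad-i₀-m)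
        where
          sm≡m : s′ m ≡ m
          sm≡m = s-fix m≢i₀ (Fin.<⇒≢ m<j₀)
          Wm≮Wi₀ : ¬ W m < W i₀
          Wm≮Wi₀ = subst₂ (λ y z → ¬ W y < W z) sm≡m refl (κ-row-j₀≡0 κj₀m≡0)
          Wi₀<Wm : W i₀ < W m
          Wi₀<Wm = ≮∧≢⇒> Wm≮Wi₀ (λ Wm≡Wi₀ → m≢i₀ (W-injective Wm≡Wi₀))
          m≤i₀ : toℕ m ≤ toℕ i₀
          m≤i₀ = ℕ.≮⇒≥ λ i₀<m → gap (m , i₀<m , m<j₀ , Wi₀<Wm , Fin.<-trans Wm<Wl Wl<Wj₀)
          sm<sj₀ : s′ m < s′ j₀
          sm<sj₀ = subst₂ _<_ (sym sm≡m) (sym (s-right i₀ j₀)) (Fin.≤∧≢⇒< m≤i₀ m≢i₀)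
          Bad-i₀-m : Bad w i₀ j₀ (s′ j₀) (s′ m)
          Bad-i₀-m = subst₂ (Bad w i₀ j₀) (sym (s-right i₀ j₀)) (sym sm≡m)
            (Bad-intro (inj₁ refl) Wm≮Wi₀
              (subst₂ (λ y z → W y < W z) (sym sm≡m) (sym (s-left i₀ j₀)) (Fin.<-trans Wm<Wl Wl<Wj₀)))

  module _ (i₀<j₀ : i₀ < j₀) (Wi₀<Wj₀ : W i₀ < W j₀) (gap : NoValueBetween) where

    violation-shape : ∀ {l m k} → m < k → k < l → κ′ l m ≡ 1 → κ′ k m ≡ 0 → κ′ l k ≡ 0 →
      ViolationShape l m k
    violation-shape {l} {m} {k} m<k k<l κlm≡1 κkm≡0 κlk≡0 = by-cases (l ≟ j₀)
      where
        by-cases : Dec (l ≡ j₀) → ViolationShape l m k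
        by-cases (yes refl) = ⊥-elim (no-violation-in-row-j₀ Wi₀<Wj₀ m<k k<l κlm≡1 κkm≡0 κlk≡0)
        by-cases (no l≢j₀) with violation-outside-row-j₀⇒k≡j₀ l≢j₀ κlm≡1 κkm≡0 κlk≡0
        ... | refl with violation-through-j₀ i₀<j₀ gap m<k k<l κlm≡1 κkm≡0 κlk≡0
        ...   | m≤i₀ , Bad-l-j₀ , alternative = (k<l , m≤i₀) , refl , Bad-l-j₀ , alternative

    κ-subadditive : ∀ l m → (toℕ l ≤ toℕ j₀ ⊎ i₀ < m) →
      ∀ k → m < k → k < l → κ′ l m ≤ κ′ k m ℕ.+ κ′ l k
    κ-subadditive l m range k m<k k<l with ≤1⇒≤+⊎1>0+0 (κ≤1 l m)
    ... | inj₁ κ≤κ+κ = κ≤κ+κ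
    ... | inj₂ (κlm≡1 , κkm≡0 , κlk≡0) with violation-shape m<k k<l κlm≡1 κkm≡0 κlk≡0 | range
    ...   | (j₀<l , _) , _    | inj₁ l≤j₀ = ⊥-elim (ℕ.<⇒≱ j₀<l l≤j₀)
    ...   | (_ , m≤i₀) , _    | inj₂ i₀<m = ⊥-elim (ℕ.<⇒≱ i₀<m m≤i₀)

    κ-violation : ∀ l m k → m < k → k < l → κ′ l m > κ′ k m ℕ.+ κ′ l k →
      (j₀ < l × toℕ m ≤ toℕ i₀) × (κ′ l m ≡ 1 × κ′ k m ≡ 0 × κ′ l k ≡ 0) × k ≡ j₀ × Bad w i₀ j₀ l k
      × ((s′ m < s′ k × Bad w i₀ j₀ (s′ k) (s′ m)) ⊎ (k ≡ j₀ × m ≡ i₀))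
    κ-violation l m k m<k k<l κ>κ+κ with ≤1⇒≤+⊎1>0+0 (κ≤1 l m)
    ... | inj₁ κ≤κ+κ = ⊥-elim (ℕ.<⇒≱ κ>κ+κ κ≤κ+κ)
    ... | inj₂ κ-values@(κlm≡1 , κkm≡0 , κlk≡0) with violation-shape m<k k<l κlm≡1 κkm≡0 κlk≡0
    ...   | range , k≡j₀ , Bad-l-k , alternative = range , κ-values , k≡j₀ , Bad-l-k , alternative

lemma3p1p3 : (n : ℕ) → 3 ≤ n → (i₀ j₀ : Fin n) → i₀ < j₀ → suc (suc (toℕ i₀)) ≤ toℕ j₀ →
    (w : Permutation′ n) → (w ⟨$⟩ʳ i₀) < (w ⟨$⟩ʳ j₀) →
    ¬ (∃[ k ] (i₀ < k × k < j₀ × (w ⟨$⟩ʳ i₀) < (w ⟨$⟩ʳ k) × (w ⟨$⟩ʳ k) < (w ⟨$⟩ʳ j₀))) →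
    (l m : Fin n) → m < l →
      (((toℕ l ≤ toℕ j₀ ⊎ i₀ < m) →
          (k : Fin n) → m < k → k < l →
          κ w i₀ j₀ l m ≤ κ w i₀ j₀ k m ℕ.+ κ w i₀ j₀ l k)
      × ((k : Fin n) → m < k → k < l →
          κ w i₀ j₀ l m > κ w i₀ j₀ k m ℕ.+ κ w i₀ j₀ l k →
          (j₀ < l × toℕ m ≤ toℕ i₀)
          × (κ w i₀ j₀ l m ≡ 1 × κ w i₀ j₀ k m ≡ 0 × κ w i₀ j₀ l k ≡ 0)
          × k ≡ j₀
          × Bad w i₀ j₀ l k
          × ((s i₀ j₀ m < s i₀ j₀ k × Bad w i₀ j₀ (s i₀ j₀ k) (s i₀ j₀ m))
             ⊎ (k ≡ j₀ × m ≡ i₀))))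
lemma3p1p3 _ _ i₀ j₀ i₀<j₀ _ w Wi₀<Wj₀ gap l m _ =
  κ-subadditive w i₀ j₀ i₀<j₀ Wi₀<Wj₀ gap l m , κ-violation w i₀ j₀ i₀<j₀ Wi₀<Wj₀ gap l m
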